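{- For every integer $n\ge1$, $$\left\lfloor\left(\sum_{k=n}^\infty\frac{(-1)^k}{B_{2k+1}}\right)^{ -1}\right\rfloor=\begin{cases}B_{2n+1}+B_{2n-1}&\text{if $n$ is even},\\ -(B_{2n+1}+B_{2n-1}+1)&\text{if $n$ is odd}.\end{cases}$$
   Context: The balancing numbers are defined by $B_0=0$, $B_1=1$, $B_n=6B_{n-1}-B_{n-2}$ for $n\ge 2$. $\lfloor x\rfloor$ denotes the floor of a real number $x$. -}

module Defs where

open import Data.Nat as ℕ using (ℕ; zero; suc)
open import Data.Integer as ℤ using (ℤ; +_)
open import Data.Rational as ℚ using (ℚ; 0ℚ; 1ℚ; _+_; _*_; _-_; -_; ∣_∣; _≤_; _<_; 1/_; ≢-nonZero)
open import Data.Rational.Properties using (_≟_)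
open import Data.Product using (Σ; ∃; _×_)
open import Relation.Nullary using (yes; no)

B : ℕ → ℤ
B zero = + 0
B (suc zero) = + 1
B (suc (suc n)) = + 6 ℤ.* B (suc n) ℤ.- B n

ι : ℤ → ℚ
ι z = z ℚ./ 1

-- reciprocal, total: 1/q for q ≠ 0 (value at 0 is irrelevant, set to 0)
inv : ℚ → ℚ
inv q with q ≟ 0ℚ
... | yes _ = 0ℚ
... | no q≢0 = 1/_ q {{≢-nonZero q≢0}}

sgn : ℕ → ℚ
sgn zero = 1ℚ
sgn (suc k) = - sgn k

term : ℕ → ℚ
term k = sgn k * inv (ι (B (suc (2 ℕ.* k))))

-- partial sum  Σ_{k=n}^{n+N} term k
partial : ℕ → ℕ → ℚ
partial n zero = term n
partial n (suc N) = partial n N + term (n ℕ.+ suc N)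

-- Real numbers as limits of rational sequences (written out via ℚ):
-- s is Cauchy, i.e. converges to a real number lim s.
IsCauchy : (ℕ → ℚ) → Set
IsCauchy s = ∀ (ε : ℚ) → 0ℚ < ε →
  ∃ λ N → ∀ i j → N ℕ.≤ i → N ℕ.≤ j → ∣ s i - s j ∣ ≤ ε

-- lim s ≠ 0 (for a Cauchy sequence: eventually bounded away from 0)
LimNonZero : (ℕ → ℚ) → Set
LimNonZero s = ∃ λ (ε : ℚ) → 0ℚ < ε × ∃ λ N → ∀ j → N ℕ.≤ j → ε ≤ ∣ s j ∣

-- q ≤ lim t
LimGe : (ℕ → ℚ) → ℚ → Set
LimGe t q = ∀ (ε : ℚ) → 0ℚ < ε → ∃ λ N → ∀ j → N ℕ.≤ j → q - ε ≤ t j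

-- lim t < q
LimLt : (ℕ → ℚ) → ℚ → Set
LimLt t q = ∃ λ (ε : ℚ) → 0ℚ < ε × ∃ λ N → ∀ j → N ℕ.≤ j → t j + ε ≤ q

-- ⌊ (lim s)⁻¹ ⌋ = m, where lim s ≠ 0; (lim s)⁻¹ = lim (1 / s j)
FloorInvLim : (ℕ → ℚ) → ℤ → Set
FloorInvLim s m = LimNonZero s ×
  (LimGe (λ j → inv (s j)) (ι m) × LimLt (λ j → inv (s j)) (ι (m ℤ.+ + 1)))

data Even : ℕ → Set where
  even0 : Even zero
  evenSS : ∀ {n} → Even n → Even (suc (suc n))

Odd : ℕ → Set
Odd n = Even (suc n)

module Submission where

-- Write b k = B (2k+1) and M j = b (j+1) + b j.  These satisfy b (k+2) + b k = 34 b (k+1) and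
-- b (k+1)² = b k · b (k+2) + 36, which give the telescoping identity
--   1/b (j+1) + 1/(b (j+1)³ - b (j+1)) = 1/M j + 1/M (j+1).
-- Summing it with alternating signs, the tail Σ_{k≥n} (-1)^(k-n) / b k equals
-- 1/M (n-1) - Σ_{k≥n} (-1)^(k-n) / (b k³ - b k) up to a boundary term that tends to 0,
-- and the second alternating sum lies between 1/c - 1/c′ and 1/c for its first two denominators c, c′.
-- These errors are far smaller than 1/M - 1/(M+1), so the reciprocal of the tail lies strictly
-- between M (n-1) = B (2n+1) + B (2n-1) and that number plus 1; the factor (-1)^n gives the two cases.
-- Without reals, the limit is handled by bounding all partial sums beyond a fixed index uniformly.

open import Defs
open import Data.Product using (_×_; _,_; proj₁; proj₂; ∃)
open import Relation.Binary.PropositionalEquality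

module BalancingNumbers where

  open import Data.Nat
  open import Data.Nat.Properties
  open import Data.Nat.Tactic.RingSolver using (solve-∀)

  Bℕ : ℕ → ℕ
  Bℕ 0 = 0
  Bℕ 1 = 1
  Bℕ (suc (suc m)) = 6 * Bℕ (suc m) ∸ Bℕ m

  Bℕ-mono : ∀ m → Bℕ m ≤ Bℕ (suc m)
  Bℕ-mono zero = z≤n
  Bℕ-mono (suc m) = begin
    x               ≤⟨ m≤n*m x 5 ⟩
    5 * x           ≡⟨ m+n∸m≡n x (5 * x) ⟨
    6 * x ∸ x       ≤⟨ ∸-monoʳ-≤ (6 * x) (Bℕ-mono m) ⟩
    6 * x ∸ Bℕ m    ∎
    where
    open ≤-Reasoning
    x : ℕ
    x = Bℕ (suc m)

  Bℕ≤6*Bℕ[1+m] : ∀ m → Bℕ m ≤ 6 * Bℕ (suc m)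
  Bℕ≤6*Bℕ[1+m] m = ≤-trans (Bℕ-mono m) (m≤n*m (Bℕ (suc m)) 6)

  Bℕ-rec : ∀ m → Bℕ (2 + m) + Bℕ m ≡ 6 * Bℕ (1 + m)
  Bℕ-rec m = m∸n+n≡m (Bℕ≤6*Bℕ[1+m] m)

  Bℕ-rec₂ : ∀ m → Bℕ (4 + m) + Bℕ m ≡ 34 * Bℕ (2 + m)
  Bℕ-rec₂ m = +-cancelʳ-≡ (2 * x₂ + 6 * x₃ + 6 * x₁) (x₄ + x₀) (34 * x₂) (begin
    x₄ + x₀ + (2 * x₂ + 6 * x₃ + 6 * x₁)         ≡⟨ regroup x₀ x₁ x₂ x₃ x₄ ⟩
    (x₄ + x₂) + 6 * (x₃ + x₁) + (x₂ + x₀)        ≡⟨ cong₂ _+_ (cong₂ _+_ (Bℕ-rec (2 + m)) (cong (6 *_) (Bℕ-rec (1 + m)))) (Bℕ-rec m) ⟩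
    6 * x₃ + 6 * (6 * x₂) + 6 * x₁               ≡⟨ collect x₁ x₂ x₃ ⟩
    34 * x₂ + (2 * x₂ + 6 * x₃ + 6 * x₁)         ∎)
    where
    open ≡-Reasoning
    x₀ x₁ x₂ x₃ x₄ : ℕ
    x₀ = Bℕ m
    x₁ = Bℕ (1 + m)
    x₂ = Bℕ (2 + m)
    x₃ = Bℕ (3 + m)
    x₄ = Bℕ (4 + m)
    regroup : ∀ x₀ x₁ x₂ x₃ x₄ → x₄ + x₀ + (2 * x₂ + 6 * x₃ + 6 * x₁) ≡ (x₄ + x₂) + 6 * (x₃ + x₁) + (x₂ + x₀)
    regroup = solve-∀
    collect : ∀ x₁ x₂ x₃ → 6 * x₃ + 6 * (6 * x₂) + 6 * x₁ ≡ 34 * x₂ + (2 * x₂ + 6 * x₃ + 6 * x₁)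
    collect = solve-∀

  b : ℕ → ℕ
  b k = Bℕ (suc (2 * k))

  b-rec : ∀ k → b (2 + k) + b k ≡ 34 * b (1 + k)
  b-rec k = begin
    b (2 + k) + b k             ≡⟨ cong (λ i → Bℕ (suc i) + b k) (trans (*-suc 2 (suc k)) (cong (2 +_) (*-suc 2 k))) ⟩
    Bℕ (4 + suc (2 * k)) + b k  ≡⟨ Bℕ-rec₂ (suc (2 * k)) ⟩
    34 * Bℕ (2 + suc (2 * k))   ≡⟨ cong (λ i → 34 * Bℕ (suc i)) (*-suc 2 k) ⟨
    34 * b (1 + k)              ∎
    where open ≡-Reasoning

  b-cassini : ∀ j → b (1 + j) * b (1 + j) ≡ b j * b (2 + j) + 36
  b-cassini zero = refl
  b-cassini (suc j) = +-cancelʳ-≡ (x * z) (z * z) (y * w + 36) (begin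
    z * z + x * z        ≡⟨ factor x z ⟩
    z * (z + x)          ≡⟨ cong (z *_) (b-rec j) ⟩
    z * (34 * y)         ≡⟨ swap y z ⟩
    y * (34 * z)         ≡⟨ cong (y *_) (b-rec (suc j)) ⟨
    y * (w + y)          ≡⟨ *-distribˡ-+ y w y ⟩
    y * w + y * y        ≡⟨ cong (_+_ (y * w)) (b-cassini j) ⟩
    y * w + (x * z + 36) ≡⟨ shift (y * w) (x * z) ⟩
    y * w + 36 + x * z   ∎)
    where
    open ≡-Reasoning
    x y z w : ℕ
    x = b j
    y = b (1 + j)
    z = b (2 + j)
    w = b (3 + j)
    factor : ∀ x z → z * z + x * z ≡ z * (z + x)
    factor = solve-∀
    swap : ∀ y z → z * (34 * y) ≡ y * (34 * z)
    swap = solve-∀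
    shift : ∀ p q → p + (q + 36) ≡ p + 36 + q
    shift = solve-∀

  b-double : ∀ k → 2 * b k ≤ b (suc k)
  b-double zero = s≤s (s≤s z≤n)
  b-double (suc k) = ≤-trans (*-monoˡ-≤ y (m≤m+n 2 31)) (+-cancelʳ-≤ y (33 * y) z (begin
    33 * y + y    ≡⟨ +-comm (33 * y) y ⟩
    34 * y        ≡⟨ b-rec k ⟨
    z + b k       ≤⟨ +-monoʳ-≤ z (≤-trans (m≤m+n (b k) (b k + 0)) (b-double k)) ⟩
    z + y         ∎))
    where
    open ≤-Reasoning
    y z : ℕ
    y = b (1 + k)
    z = b (2 + k)

  b-mono : ∀ k → b k ≤ b (suc k)
  b-mono k = ≤-trans (m≤m+n (b k) (b k + 0)) (b-double k)

  b-mono-≤ : ∀ {i j} → i ≤ j → b i ≤ b j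
  b-mono-≤ i≤j = go (≤⇒≤′ i≤j)
    where
    go : ∀ {i j} → i ≤′ j → b i ≤ b j
    go ≤′-refl = ≤-refl
    go (≤′-step {j} i≤′j) = ≤-trans (go i≤′j) (b-mono j)

  b-pos : ∀ k → 0 < b k
  b-pos k = b-mono-≤ {0} {k} z≤n

  n<b : ∀ k → k < b k
  n<b zero = s≤s z≤n
  n<b (suc k) = begin
    suc (suc k)   ≤⟨ s≤s (n<b k) ⟩
    suc (b k)     ≤⟨ +-monoˡ-≤ (b k) (b-pos k) ⟩
    b k + b k     ≡⟨ cong (b k +_) (+-identityʳ (b k)) ⟨
    2 * b k       ≤⟨ b-double k ⟩
    b (suc k)     ∎
    where open ≤-Reasoning

  c : ℕ → ℕ
  c y = pred y * y * suc y

  c-pos : ∀ {y} → 2 ≤ y → 0 < c y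
  c-pos {suc (suc t)} _ = s≤s z≤n
  c-pos {suc zero} (s≤s ())

  c∘b-pos : ∀ k → 0 < c (b (suc k))
  c∘b-pos k = c-pos (≤-trans (s≤s (s≤s z≤n)) (b-mono-≤ {1} {suc k} (s≤s z≤n)))

  c-double : ∀ {x y} → 2 * x ≤ y → 2 * c x ≤ c y
  c-double {x} {y} 2x≤y = begin
    2 * (pred x * x * suc x)    ≡⟨ rearrange (pred x) x (suc x) ⟩
    pred x * (2 * x) * suc x    ≤⟨ *-mono-≤ (*-mono-≤ (pred-mono-≤ x≤y) 2x≤y) (s≤s x≤y) ⟩
    pred y * y * suc y          ∎
    where
    open ≤-Reasoning
    x≤y : x ≤ y
    x≤y = ≤-trans (m≤m+n x (x + 0)) 2x≤y
    rearrange : ∀ u v w → 2 * (u * v * w) ≡ u * (2 * v) * w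
    rearrange = solve-∀

  telescoping-identity : ∀ x y z → 0 < y → z + x ≡ 34 * y → y * y ≡ x * z + 36 →
    (c y + y) * ((y + x) * (z + y)) ≡ ((z + y) + (y + x)) * (y * c y)
  telescoping-identity x (suc t) z _ z+x≡34y y²≡xz+36 = begin
    (c y + y) * ((y + x) * (z + y))      ≡⟨ cong ((c y + y) *_) product ⟩
    (c y + y) * (36 * t * (t + 2))       ≡⟨ expand t ⟩
    (36 * y) * (y * c y)                 ≡⟨ cong (_* (y * c y)) sum ⟨
    ((z + y) + (y + x)) * (y * c y)      ∎
    where
    open ≡-Reasoning
    y : ℕ
    y = suc t
    product : (y + x) * (z + y) ≡ 36 * t * (t + 2)
    product = +-cancelʳ-≡ 36 _ _ (begin
      (y + x) * (z + y) + 36               ≡⟨ distribute x y z ⟩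
      y * (z + x) + y * y + (x * z + 36)   ≡⟨ cong₂ (λ u v → y * u + y * y + v) z+x≡34y (sym y²≡xz+36) ⟩
      y * (34 * y) + y * y + y * y         ≡⟨ collect t ⟩
      36 * t * (t + 2) + 36                ∎)
      where
      distribute : ∀ x y z → (y + x) * (z + y) + 36 ≡ y * (z + x) + y * y + (x * z + 36)
      distribute = solve-∀
      collect : ∀ t → suc t * (34 * suc t) + suc t * suc t + suc t * suc t ≡ 36 * t * (t + 2) + 36
      collect = solve-∀
    sum : (z + y) + (y + x) ≡ 36 * y
    sum = begin
      (z + y) + (y + x)    ≡⟨ regroup x y z ⟩
      (z + x) + 2 * y      ≡⟨ cong (_+ 2 * y) z+x≡34y ⟩
      34 * y + 2 * y       ≡⟨ *-distribʳ-+ y 34 2 ⟨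
      36 * y               ∎
      where
      regroup : ∀ x y z → (z + y) + (y + x) ≡ (z + x) + 2 * y
      regroup = solve-∀
    expand : ∀ t → (t * suc t * suc (suc t) + suc t) * (36 * t * (t + 2)) ≡ (36 * suc t) * (suc t * (t * suc t * suc (suc t)))
    expand = solve-∀

  c-cross : ∀ c₀ c₁ → 0 < c₀ → 2 * c₀ ≤ c₁ → (c₁ + 4 * c₀) * c₀ < 4 * c₀ * c₁
  c-cross (suc u) _ _ 2c₀≤c₁ with m≤n⇒∃[o]m+o≡n 2c₀≤c₁
  ... | r , refl = subst ((2 * suc u + r + 4 * suc u) * suc u <_) (sym (gap u r)) (m<m+n _ (s≤s z≤n))
    where
    gap : ∀ u r → 4 * suc u * (2 * suc u + r) ≡ (2 * suc u + r + 4 * suc u) * suc u + suc (2 * u * u + 4 * u + 1 + 3 * r * u + 3 * r)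
    gap = solve-∀

  M-cross : ∀ M c₀ → 5 * M * (M + 1) < 4 * c₀ →
    ((4 * c₀ + (M + 1)) * c₀ + (M + 1) * (4 * c₀)) * M < (M + 1) * (4 * c₀) * c₀
  M-cross M (suc u) 5M[M+1]<4c₀ = subst₂ _<_ (sym (lhs M (suc u))) (sym (rhs M (suc u)))
      (+-monoʳ-< (4 * suc u * suc u * M) (*-monoˡ-< (suc u) 5M[M+1]<4c₀))
    where
    lhs : ∀ M c₀ → ((4 * c₀ + (M + 1)) * c₀ + (M + 1) * (4 * c₀)) * M ≡ 4 * c₀ * c₀ * M + 5 * M * (M + 1) * c₀
    lhs = solve-∀
    rhs : ∀ M c₀ → (M + 1) * (4 * c₀) * c₀ ≡ 4 * c₀ * c₀ * M + 4 * c₀ * c₀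
    rhs = solve-∀

  5M[M+1]<4c : ∀ M y → M ≤ 2 * y → 6 ≤ y → 5 * M * (M + 1) < 4 * c y
  5M[M+1]<4c M (suc t) M≤2y 6≤y with m≤n⇒∃[o]m+o≡n (s≤s⁻¹ 6≤y)
  ... | s , refl = ≤-<-trans (*-mono-≤ (*-monoʳ-≤ 5 M≤2y) (+-monoˡ-≤ 1 M≤2y))
      (subst (5 * (2 * y) * (2 * y + 1) <_) (sym (gap s)) (m<m+n _ (s≤s z≤n)))
    where
    y : ℕ
    y = suc (5 + s)
    gap : ∀ s → 4 * ((5 + s) * suc (5 + s) * suc (suc (5 + s))) ≡ 5 * (2 * suc (5 + s)) * (2 * suc (5 + s) + 1) + suc (59 + 178 * s + 52 * s * s + 4 * s * s * s)
    gap = solve-∀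

open BalancingNumbers
open import Data.Nat as ℕ using (ℕ; zero; suc)
import Data.Nat.Properties as ℕₚ
open import Data.Integer as ℤ using (ℤ; +_)
import Data.Integer.Properties as ℤₚ
open import Data.Rational using (ℚ; mkℚ; _/_; ↥_; ↧_; 0ℚ; 1ℚ; _+_; _*_; _-_; -_; ∣_∣; _≤_; _<_; *≤*; *<*; ≢-nonZero; positive; nonNegative)
import Data.Rational.Properties as ℚₚ
import Data.Rational.Unnormalised as ℚᵘ
import Data.Nat.Coprimality as Coprimality
open import Data.Empty using (⊥-elim)
open import Function using (_∘_)
open import Relation.Nullary using (yes; no)
open import Data.Rational.Solver using (module +-*-Solver)
open +-*-Solver
open import Data.Integer.Tactic.RingSolver using (solve-∀)

-- Integers and unit fractions in ℚ

ι-def : ∀ z → ι z ≡ mkℚ z 0 (Coprimality.sym (Coprimality.1-coprimeTo ℤ.∣ z ∣))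
ι-def z = ℚₚ.↥p/↧p≡p (mkℚ z 0 _)

ι-+ : ∀ x y → ι (x ℤ.+ y) ≡ ι x + ι y
ι-+ x y rewrite ι-def x | ι-def y =
  cong (_/ 1) (sym (cong₂ ℤ._+_ (ℤₚ.*-identityʳ x) (ℤₚ.*-identityʳ y)))

ι-* : ∀ x y → ι (x ℤ.* y) ≡ ι x * ι y
ι-* x y rewrite ι-def x | ι-def y = refl

ι-neg : ∀ x → ι (ℤ.- x) ≡ - ι x
ι-neg x = begin
  ι (ℤ.- x)                  ≡⟨ solve 2 (λ u v → u := (u :+ v) :- v) refl (ι (ℤ.- x)) (ι x) ⟩
  ι (ℤ.- x) + ι x - ι x      ≡⟨ cong (_- ι x) (trans (sym (ι-+ (ℤ.- x) x)) (cong ι (ℤₚ.+-inverseˡ x))) ⟩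
  0ℚ - ι x                   ≡⟨ ℚₚ.+-identityˡ (- ι x) ⟩
  - ι x                      ∎
  where open ≡-Reasoning

ι-mono-≤ : ∀ {x y} → x ℤ.≤ y → ι x ≤ ι y
ι-mono-≤ {x} {y} x≤y rewrite ι-def x | ι-def y =
  *≤* (subst₂ ℤ._≤_ (sym (ℤₚ.*-identityʳ x)) (sym (ℤₚ.*-identityʳ y)) x≤y)

ι-mono-< : ∀ {x y} → x ℤ.< y → ι x < ι y
ι-mono-< {x} {y} x<y rewrite ι-def x | ι-def y =
  *<* (subst₂ ℤ._<_ (sym (ℤₚ.*-identityʳ x)) (sym (ℤₚ.*-identityʳ y)) x<y)

pos⇒≢0 : ∀ {x} → 0ℚ < x → x ≢ 0ℚ
pos⇒≢0 0<x x≡0 = ℚₚ.<-irrefl (sym x≡0) 0<x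

x-y≤x : ∀ x {y} → 0ℚ ≤ y → x - y ≤ x
x-y≤x x 0≤y = subst (x - _ ≤_) (ℚₚ.+-identityʳ x) (ℚₚ.+-monoʳ-≤ x (ℚₚ.neg-antimono-≤ 0≤y))

0≤x-y : ∀ {x y} → y ≤ x → 0ℚ ≤ x - y
0≤x-y {x} {y} y≤x = subst (_≤ x - y) (ℚₚ.+-inverseʳ y) (ℚₚ.+-monoˡ-≤ (- y) y≤x)

0<y-x : ∀ {x y} → x < y → 0ℚ < y - x
0<y-x {x} {y} x<y = subst (_< y - x) (ℚₚ.+-inverseʳ x) (ℚₚ.+-monoˡ-< (- x) x<y)

x+[y-z]<x : ∀ x {y z} → y < z → x + (y - z) < x
x+[y-z]<x x {y} {z} y<z = subst (x + (y - z) <_) (ℚₚ.+-identityʳ x) (ℚₚ.+-monoʳ-< x (ℚₚ.<-≤-trans (ℚₚ.+-monoˡ-< (- z) y<z) (ℚₚ.≤-reflexive (ℚₚ.+-inverseʳ z))))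

x≤y⇒x+[z-y]≤z : ∀ {x y} z → x ≤ y → x + (z - y) ≤ z
x≤y⇒x+[z-y]≤z {x} {y} z x≤y = subst (x + (z - y) ≤_) (solve 2 (λ y z → y :+ (z :- y) := z) refl y z) (ℚₚ.+-monoˡ-≤ (z - y) x≤y)

inv-inverseʳ : ∀ x → x ≢ 0ℚ → x * inv x ≡ 1ℚ
inv-inverseʳ x x≢0 with x ℚₚ.≟ 0ℚ
... | yes x≡0 = ⊥-elim (x≢0 x≡0)
... | no x≢0′ = ℚₚ.*-inverseʳ x {{≢-nonZero x≢0′}}

inv-pos : ∀ {x} → 0ℚ < x → 0ℚ < inv x
inv-pos {x} 0<x with x ℚₚ.≟ 0ℚ
... | yes x≡0 = ⊥-elim (pos⇒≢0 0<x x≡0)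
... | no _ = ℚₚ.positive⁻¹ _ {{ℚₚ.1/pos⇒pos x {{positive 0<x}}}}

inv-cancelˡ : ∀ x z → x ≢ 0ℚ → x * (inv x * z) ≡ z
inv-cancelˡ x z x≢0 = begin
  x * (inv x * z)   ≡⟨ ℚₚ.*-assoc x (inv x) z ⟨
  x * inv x * z     ≡⟨ cong (_* z) (inv-inverseʳ x x≢0) ⟩
  1ℚ * z            ≡⟨ ℚₚ.*-identityˡ z ⟩
  z                 ∎
  where open ≡-Reasoning

inv-unique : ∀ x y → x * y ≡ 1ℚ → inv x ≡ y
inv-unique x y xy≡1 = begin
  inv x              ≡⟨ ℚₚ.*-identityʳ (inv x) ⟨
  inv x * 1ℚ         ≡⟨ cong (inv x *_) xy≡1 ⟨
  inv x * (x * y)    ≡⟨ solve 3 (λ u x y → u :* (x :* y) := x :* (u :* y)) refl (inv x) x y ⟩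
  x * (inv x * y)    ≡⟨ inv-cancelˡ x y x≢0 ⟩
  y                  ∎
  where
  open ≡-Reasoning
  x≢0 : x ≢ 0ℚ
  x≢0 x≡0 = ℚₚ.1≢0 (trans (sym xy≡1) (trans (cong (_* y) x≡0) (ℚₚ.*-zeroˡ y)))

inv-involutive : ∀ x → x ≢ 0ℚ → inv (inv x) ≡ x
inv-involutive x x≢0 = inv-unique (inv x) x (trans (ℚₚ.*-comm (inv x) x) (inv-inverseʳ x x≢0))

inv-neg : ∀ x → x ≢ 0ℚ → inv (- x) ≡ - inv x
inv-neg x x≢0 = inv-unique (- x) (- inv x)
  (trans (solve 2 (λ x y → (:- x) :* (:- y) := x :* y) refl x (inv x)) (inv-inverseʳ x x≢0))

module _ {x y : ℚ} (0<x : 0ℚ < x) (0<y : 0ℚ < y) where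

  private
    r : ℚ
    r = inv x * inv y

    0<r : 0ℚ < r
    0<r = ℚₚ.positive⁻¹ r {{ℚₚ.pos*pos⇒pos (inv x) {{positive (inv-pos 0<x)}} (inv y) {{positive (inv-pos 0<y)}}}}

    x*r≡inv-y : x * r ≡ inv y
    x*r≡inv-y = inv-cancelˡ x (inv y) (pos⇒≢0 0<x)

    y*r≡inv-x : y * r ≡ inv x
    y*r≡inv-x = trans (cong (y *_) (ℚₚ.*-comm (inv x) (inv y))) (inv-cancelˡ y (inv x) (pos⇒≢0 0<y))

  inv-antimono-≤ : x ≤ y → inv y ≤ inv x
  inv-antimono-≤ x≤y = subst₂ _≤_ x*r≡inv-y y*r≡inv-x (ℚₚ.*-monoʳ-≤-nonNeg r {{nonNegative (ℚₚ.<⇒≤ 0<r)}} x≤y)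

  inv-antimono-< : x < y → inv y < inv x
  inv-antimono-< x<y = subst₂ _<_ x*r≡inv-y y*r≡inv-x (ℚₚ.*-monoˡ-<-pos r {{positive 0<r}} x<y)

-- ℚ's _*_ is computed in ℚᵘ and then normalised, so the product is identified by cross-multiplication.
ι↧*≡ι↥ : ∀ p → ι (↧ p) * p ≡ ι (↥ p)
ι↧*≡ι↥ p@(mkℚ n d _) rewrite ι-def (↧ p) =
  ℚₚ.fromℚᵘ-cong {ℚᵘ.mkℚᵘ (+ suc d ℤ.* n) (d ℕ.+ 0)} {ℚᵘ.mkℚᵘ n 0} (ℚᵘ.*≡* (begin
    + suc d ℤ.* n ℤ.* + 1      ≡⟨ ℤₚ.*-identityʳ _ ⟩
    + suc d ℤ.* n              ≡⟨ ℤₚ.*-comm (+ suc d) n ⟩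
    n ℤ.* + suc d              ≡⟨ cong (λ e → n ℤ.* + suc e) (ℕₚ.+-identityʳ d) ⟨
    n ℤ.* + suc (d ℕ.+ 0)      ∎))
  where open ≡-Reasoning

⅟ : ℕ → ℚ
⅟ q = inv (ι (+ q))

infixl 7 _÷_
_÷_ : ℕ → ℕ → ℚ
p ÷ q = ι (+ p) * ⅟ q

ι-pos : ∀ {q} → 0 ℕ.< q → 0ℚ < ι (+ q)
ι-pos 0<q = ι-mono-< (ℤ.+<+ 0<q)

ι*⅟ : ∀ {q} → 0 ℕ.< q → ι (+ q) * ⅟ q ≡ 1ℚ
ι*⅟ 0<q = inv-inverseʳ _ (pos⇒≢0 (ι-pos 0<q))

inv-⅟ : ∀ {q} → 0 ℕ.< q → inv (⅟ q) ≡ ι (+ q)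
inv-⅟ 0<q = inv-involutive _ (pos⇒≢0 (ι-pos 0<q))

⅟-pos : ∀ {q} → 0 ℕ.< q → 0ℚ < ⅟ q
⅟-pos 0<q = inv-pos (ι-pos 0<q)

⅟-nonNeg : ∀ q → 0ℚ ≤ ⅟ q
⅟-nonNeg zero = ℚₚ.≤-refl
⅟-nonNeg (suc q) = ℚₚ.<⇒≤ (⅟-pos {suc q} (ℕ.s≤s ℕ.z≤n))

⅟≡1÷ : ∀ q → ⅟ q ≡ 1 ÷ q
⅟≡1÷ q = sym (ℚₚ.*-identityˡ (⅟ q))

ι-+-ℕ : ∀ m n → ι (+ (m ℕ.+ n)) ≡ ι (+ m) + ι (+ n)
ι-+-ℕ m n = ι-+ (+ m) (+ n)

ι-*-ℕ : ∀ m n → ι (+ (m ℕ.* n)) ≡ ι (+ m) * ι (+ n)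
ι-*-ℕ m n = trans (cong ι (ℤₚ.pos-* m n)) (ι-* (+ m) (+ n))

⅟-* : ∀ {m n} → 0 ℕ.< m → 0 ℕ.< n → ⅟ (m ℕ.* n) ≡ ⅟ m * ⅟ n
⅟-* {m} {n} 0<m 0<n = inv-unique (ι (+ (m ℕ.* n))) (⅟ m * ⅟ n) (begin
  ι (+ (m ℕ.* n)) * (⅟ m * ⅟ n)       ≡⟨ cong (_* (⅟ m * ⅟ n)) (ι-*-ℕ m n) ⟩
  ι (+ m) * ι (+ n) * (⅟ m * ⅟ n)     ≡⟨ solve 4 (λ a b c d → a :* b :* (c :* d) := (a :* c) :* (b :* d)) refl (ι (+ m)) (ι (+ n)) (⅟ m) (⅟ n) ⟩
  (ι (+ m) * ⅟ m) * (ι (+ n) * ⅟ n)   ≡⟨ cong₂ _*_ (ι*⅟ 0<m) (ι*⅟ 0<n) ⟩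
  1ℚ                                  ∎)
  where open ≡-Reasoning

÷-scale : ∀ p q {k} → 0 ℕ.< q → 0 ℕ.< k → p ÷ q ≡ (p ℕ.* k) ÷ (q ℕ.* k)
÷-scale p q {k} 0<q 0<k = begin
  ι (+ p) * ⅟ q                              ≡⟨ ℚₚ.*-identityʳ _ ⟨
  ι (+ p) * ⅟ q * 1ℚ                         ≡⟨ cong (ι (+ p) * ⅟ q *_) (ι*⅟ 0<k) ⟨
  ι (+ p) * ⅟ q * (ι (+ k) * ⅟ k)            ≡⟨ solve 4 (λ a b c d → a :* b :* (c :* d) := (a :* c) :* (b :* d)) refl (ι (+ p)) (⅟ q) (ι (+ k)) (⅟ k) ⟩
  (ι (+ p) * ι (+ k)) * (⅟ q * ⅟ k)          ≡⟨ cong₂ _*_ (ι-*-ℕ p k) (⅟-* 0<q 0<k) ⟨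
  (p ℕ.* k) ÷ (q ℕ.* k)                      ∎
  where open ≡-Reasoning

÷-scale′ : ∀ p q {k} → 0 ℕ.< q → 0 ℕ.< k → p ÷ q ≡ (p ℕ.* k) ÷ (k ℕ.* q)
÷-scale′ p q {k} 0<q 0<k = trans (÷-scale p q 0<q 0<k) (cong ((p ℕ.* k) ÷_) (ℕₚ.*-comm q k))

÷-cong : ∀ p q p′ q′ → 0 ℕ.< q → 0 ℕ.< q′ → p ℕ.* q′ ≡ p′ ℕ.* q → p ÷ q ≡ p′ ÷ q′
÷-cong p q p′ q′ 0<q 0<q′ eq = begin
  p ÷ q                         ≡⟨ ÷-scale p q 0<q 0<q′ ⟩
  (p ℕ.* q′) ÷ (q ℕ.* q′)       ≡⟨ cong (_÷ (q ℕ.* q′)) eq ⟩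
  (p′ ℕ.* q) ÷ (q ℕ.* q′)       ≡⟨ ÷-scale′ p′ q′ 0<q′ 0<q ⟨
  p′ ÷ q′                       ∎
  where open ≡-Reasoning

÷-distribʳ-+ : ∀ m n q → m ÷ q + n ÷ q ≡ (m ℕ.+ n) ÷ q
÷-distribʳ-+ m n q = trans (sym (ℚₚ.*-distribʳ-+ (⅟ q) (ι (+ m)) (ι (+ n)))) (cong (_* ⅟ q) (sym (ι-+-ℕ m n)))

÷-+ : ∀ p q p′ q′ → 0 ℕ.< q → 0 ℕ.< q′ → p ÷ q + p′ ÷ q′ ≡ (p ℕ.* q′ ℕ.+ p′ ℕ.* q) ÷ (q ℕ.* q′)
÷-+ p q p′ q′ 0<q 0<q′ = trans (cong₂ _+_ (÷-scale p q 0<q 0<q′) (÷-scale′ p′ q′ 0<q′ 0<q))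
                               (÷-distribʳ-+ (p ℕ.* q′) (p′ ℕ.* q) (q ℕ.* q′))

÷-monoˡ-< : ∀ {m n q} → 0 ℕ.< q → m ℕ.< n → m ÷ q < n ÷ q
÷-monoˡ-< {q = q} 0<q m<n = ℚₚ.*-monoˡ-<-pos (⅟ q) {{positive (⅟-pos 0<q)}} (ι-mono-< (ℤ.+<+ m<n))

⅟-+ : ∀ {p q} → 0 ℕ.< p → 0 ℕ.< q → ⅟ p + ⅟ q ≡ (q ℕ.+ p) ÷ (p ℕ.* q)
⅟-+ {p} {q} 0<p 0<q = begin
  ⅟ p + ⅟ q                                  ≡⟨ cong₂ _+_ (⅟≡1÷ p) (⅟≡1÷ q) ⟩
  1 ÷ p + 1 ÷ q                              ≡⟨ ÷-+ 1 p 1 q 0<p 0<q ⟩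
  (1 ℕ.* q ℕ.+ 1 ℕ.* p) ÷ (p ℕ.* q)          ≡⟨ cong (λ r → r ÷ (p ℕ.* q)) (cong₂ ℕ._+_ (ℕₚ.*-identityˡ q) (ℕₚ.*-identityˡ p)) ⟩
  (q ℕ.+ p) ÷ (p ℕ.* q)                      ∎
  where open ≡-Reasoning

÷+⅟ : ∀ p {q q′} → 0 ℕ.< q → 0 ℕ.< q′ → p ÷ q + ⅟ q′ ≡ (p ℕ.* q′ ℕ.+ q) ÷ (q ℕ.* q′)
÷+⅟ p {q} {q′} 0<q 0<q′ = begin
  p ÷ q + ⅟ q′                               ≡⟨ cong (_+_ (p ÷ q)) (⅟≡1÷ q′) ⟩
  p ÷ q + 1 ÷ q′                             ≡⟨ ÷-+ p q 1 q′ 0<q 0<q′ ⟩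
  (p ℕ.* q′ ℕ.+ 1 ℕ.* q) ÷ (q ℕ.* q′)        ≡⟨ cong (λ r → (p ℕ.* q′ ℕ.+ r) ÷ (q ℕ.* q′)) (ℕₚ.*-identityˡ q) ⟩
  (p ℕ.* q′ ℕ.+ q) ÷ (q ℕ.* q′)              ∎
  where open ≡-Reasoning

÷<⅟ : ∀ p {q q′} → 0 ℕ.< q → 0 ℕ.< q′ → p ℕ.* q′ ℕ.< q → p ÷ q < ⅟ q′
÷<⅟ p {q} {q′} 0<q 0<q′ pq′<q = begin-strict
  p ÷ q                     ≡⟨ ÷-scale p q 0<q 0<q′ ⟩
  (p ℕ.* q′) ÷ (q ℕ.* q′)   <⟨ ÷-monoˡ-< (ℕₚ.*-mono-< 0<q 0<q′) pq′<q ⟩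
  q ÷ (q ℕ.* q′)            ≡⟨ cong (_÷ (q ℕ.* q′)) (ℕₚ.*-identityˡ q) ⟨
  (1 ℕ.* q) ÷ (q ℕ.* q′)    ≡⟨ ÷-scale′ 1 q′ 0<q′ 0<q ⟨
  1 ÷ q′                    ≡⟨ ⅟≡1÷ q′ ⟨
  ⅟ q′                      ∎
  where open ℚₚ.≤-Reasoning

⅟-antimono-≤ : ∀ {p q} → 0 ℕ.< p → p ℕ.≤ q → ⅟ q ≤ ⅟ p
⅟-antimono-≤ 0<p p≤q = inv-antimono-≤ (ι-pos 0<p) (ι-pos (ℕₚ.<-≤-trans 0<p p≤q)) (ι-mono-≤ (ℤ.+≤+ p≤q))

⅟-archimedean : ∀ ε → 0ℚ < ε → ∃ λ D → ∀ u → D ℕ.≤ u → ⅟ u ≤ ε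
⅟-archimedean ε@(mkℚ (+ suc k) d _) 0<ε = D , λ u D≤u → ℚₚ.≤-trans (⅟-antimono-≤ (ℕ.s≤s ℕ.z≤n) D≤u) ⅟D≤ε
  where
  D : ℕ
  D = suc d
  ⅟D≤ε : ⅟ D ≤ ε
  ⅟D≤ε = begin
    ⅟ D                        ≡⟨ ℚₚ.*-identityʳ (⅟ D) ⟨
    ⅟ D * 1ℚ                   ≤⟨ ℚₚ.*-monoˡ-≤-nonNeg (⅟ D) {{nonNegative (⅟-nonNeg D)}} (ι-mono-≤ {+ 1} {+ suc k} (ℤ.+≤+ (ℕ.s≤s ℕ.z≤n))) ⟩
    ⅟ D * ι (+ suc k)          ≡⟨ cong (⅟ D *_) (ι↧*≡ι↥ ε) ⟨
    ⅟ D * (ι (+ D) * ε)        ≡⟨ solve 3 (λ u x e → u :* (x :* e) := x :* (u :* e)) refl (⅟ D) (ι (+ D)) ε ⟩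
    ι (+ D) * (⅟ D * ε)        ≡⟨ inv-cancelˡ (ι (+ D)) ε (pos⇒≢0 (ι-pos {D} (ℕ.s≤s ℕ.z≤n))) ⟩
    ε                          ∎
    where open ℚₚ.≤-Reasoning
⅟-archimedean (mkℚ (+ 0) _ _) (*<* (ℤ.+<+ ()))
⅟-archimedean (mkℚ ℤ.-[1+ _ ] _ _) (*<* ())

-- Signs and alternating sums

sgn-+ : ∀ i j → sgn (i ℕ.+ j) ≡ sgn i * sgn j
sgn-+ zero j = sym (ℚₚ.*-identityˡ (sgn j))
sgn-+ (suc i) j = trans (cong -_ (sgn-+ i j)) (ℚₚ.neg-distribˡ-* (sgn i) (sgn j))

∣sgn∣≡1 : ∀ k → ∣ sgn k ∣ ≡ 1ℚ
∣sgn∣≡1 zero = refl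
∣sgn∣≡1 (suc k) = trans (ℚₚ.∣-p∣≡∣p∣ (sgn k)) (∣sgn∣≡1 k)

sgn-even : ∀ {n} → Even n → sgn n ≡ 1ℚ
sgn-even even0 = refl
sgn-even (evenSS {n} even) = trans (solve 1 (λ x → :- :- x := x) refl (sgn n)) (sgn-even even)

sgn-odd : ∀ {n} → Odd n → sgn n ≡ - 1ℚ
sgn-odd {n} odd = trans (solve 1 (λ x → x := :- :- x) refl (sgn n)) (cong -_ (sgn-even odd))

sgn-bounds : ∀ j {x} → 0ℚ ≤ x → - x ≤ sgn j * x × sgn j * x ≤ x
sgn-bounds zero {x} 0≤x = subst (- x ≤_) (sym (ℚₚ.*-identityˡ x)) (ℚₚ.≤-trans (ℚₚ.neg-antimono-≤ 0≤x) 0≤x) ,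
                          ℚₚ.≤-reflexive (ℚₚ.*-identityˡ x)
sgn-bounds (suc j) {x} 0≤x with sgn-bounds j 0≤x
... | lower , upper = subst (- x ≤_) neg-sgn* (ℚₚ.neg-antimono-≤ upper) ,
                      subst₂ _≤_ neg-sgn* (solve 1 (λ x → :- :- x := x) refl x) (ℚₚ.neg-antimono-≤ lower)
  where
  neg-sgn* : - (sgn j * x) ≡ - sgn j * x
  neg-sgn* = ℚₚ.neg-distribˡ-* (sgn j) x

-- alt d N = Σ_{i ≤ N} (-1)^i d i
alt : (ℕ → ℚ) → ℕ → ℚ
alt d zero = d 0
alt d (suc N) = d 0 - alt (d ∘ suc) N

NonNeg Antitone : (ℕ → ℚ) → Set
NonNeg d = ∀ i → 0ℚ ≤ d i
Antitone d = ∀ i → d (suc i) ≤ d i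

antitone-≤ : ∀ {d} → Antitone d → ∀ {i j} → i ℕ.≤ j → d j ≤ d i
antitone-≤ {d} d↓ i≤j = go (ℕₚ.≤⇒≤′ i≤j)
  where
  go : ∀ {i j} → i ℕ.≤′ j → d j ≤ d i
  go ℕ.≤′-refl = ℚₚ.≤-refl
  go (ℕ.≤′-step {j} i≤′j) = ℚₚ.≤-trans (d↓ j) (go i≤′j)

alt-bounds : ∀ {d} → NonNeg d → Antitone d → ∀ N → d 0 - d 1 ≤ alt d N × alt d N ≤ d 0
alt-bounds d≥0 d↓ zero = x-y≤x _ (d≥0 1) , ℚₚ.≤-refl
alt-bounds {d} d≥0 d↓ (suc N) with alt-bounds (d≥0 ∘ suc) (d↓ ∘ suc) N
... | lower , upper = ℚₚ.+-monoʳ-≤ (d 0) (ℚₚ.neg-antimono-≤ upper) ,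
                      x-y≤x (d 0) (ℚₚ.≤-trans (0≤x-y (d↓ 1)) lower)

alt-nonNeg : ∀ {d} → NonNeg d → Antitone d → ∀ N → 0ℚ ≤ alt d N
alt-nonNeg d≥0 d↓ N = ℚₚ.≤-trans (0≤x-y (d↓ 0)) (proj₁ (alt-bounds d≥0 d↓ N))

alt-snoc : ∀ d N → alt d (suc N) ≡ alt d N + sgn (suc N) * d (suc N)
alt-snoc d zero = solve 2 (λ x y → x :- y := x :+ (:- con 1ℚ) :* y) refl (d 0) (d 1)
alt-snoc d (suc N) = begin
  d 0 - alt (d ∘ suc) (suc N)                                      ≡⟨ cong (_-_ (d 0)) (alt-snoc (d ∘ suc) N) ⟩
  d 0 - (alt (d ∘ suc) N + sgn (suc N) * d (suc (suc N)))                ≡⟨ solve 4 (λ x a s y → x :- (a :+ s :* y) := (x :- a) :+ (:- s) :* y) refl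
                                                                        (d 0) (alt (d ∘ suc) N) (sgn (suc N)) (d (suc (suc N))) ⟩
  (d 0 - alt (d ∘ suc) N) + sgn (suc (suc N)) * d (suc (suc N))                ∎
  where open ≡-Reasoning

alt-telescope : ∀ d e m → (∀ i → d i + e i ≡ m i + m (suc i)) →
  ∀ N → alt d N ≡ m 0 + sgn N * m (suc N) - alt e N
alt-telescope d e m d+e≡m+m zero = begin
  d 0                    ≡⟨ solve 2 (λ x y → x := (x :+ y) :- y) refl (d 0) (e 0) ⟩
  d 0 + e 0 - e 0        ≡⟨ cong (_- e 0) (d+e≡m+m 0) ⟩
  m 0 + m 1 - e 0        ≡⟨ cong (λ x → m 0 + x - e 0) (ℚₚ.*-identityˡ (m 1)) ⟨
  m 0 + 1ℚ * m 1 - e 0   ∎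
  where open ≡-Reasoning
alt-telescope d e m d+e≡m+m (suc N) = begin
  d 0 - alt (d ∘ suc) N
    ≡⟨ cong₂ _-_ (alt-telescope d e m d+e≡m+m 0) (alt-telescope (d ∘ suc) (e ∘ suc) (m ∘ suc) (d+e≡m+m ∘ suc) N) ⟩
  (m 0 + 1ℚ * m 1 - e 0) - (m 1 + sgn N * m (suc (suc N)) - alt (e ∘ suc) N)
    ≡⟨ solve 6 (λ m₀ m₁ e₀ s y a → (m₀ :+ con 1ℚ :* m₁ :- e₀) :- (m₁ :+ s :* y :- a) := m₀ :+ (:- s) :* y :- (e₀ :- a)) refl
         (m 0) (m 1) (e 0) (sgn N) (m (suc (suc N))) (alt (e ∘ suc) N) ⟩
  m 0 + sgn (suc N) * m (suc (suc N)) - alt e (suc N)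
    ∎
  where open ≡-Reasoning

∣x-y∣≡∣y-x∣ : ∀ x y → ∣ x - y ∣ ≡ ∣ y - x ∣
∣x-y∣≡∣y-x∣ x y = trans (sym (ℚₚ.∣-p∣≡∣p∣ (x - y))) (cong ∣_∣ (solve 2 (λ x y → :- (x :- y) := y :- x) refl x y))

alt-tail : ∀ {d} → NonNeg d → Antitone d → ∀ K N → ∣ alt d (suc (K ℕ.+ N)) - alt d K ∣ ≤ d (suc K)
alt-tail {d} d≥0 d↓ zero N = subst (_≤ d 1) (sym ∣d₀-a-d₀∣≡a) (proj₂ (alt-bounds (d≥0 ∘ suc) (d↓ ∘ suc) N))
  where
  a : ℚ
  a = alt (d ∘ suc) N
  ∣d₀-a-d₀∣≡a : ∣ d 0 - a - d 0 ∣ ≡ a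
  ∣d₀-a-d₀∣≡a = begin
    ∣ d 0 - a - d 0 ∣   ≡⟨ cong ∣_∣ (solve 2 (λ x a → x :- a :- x := :- a) refl (d 0) a) ⟩
    ∣ - a ∣             ≡⟨ ℚₚ.∣-p∣≡∣p∣ a ⟩
    ∣ a ∣               ≡⟨ ℚₚ.0≤p⇒∣p∣≡p (alt-nonNeg (d≥0 ∘ suc) (d↓ ∘ suc) N) ⟩
    a                   ∎
    where open ≡-Reasoning
alt-tail {d} d≥0 d↓ (suc K) N = subst (_≤ d (suc (suc K))) (sym ∣d₀-x-[d₀-y]∣≡∣x-y∣) (alt-tail (d≥0 ∘ suc) (d↓ ∘ suc) K N)
  where
  x y : ℚ
  x = alt (d ∘ suc) (suc (K ℕ.+ N))
  y = alt (d ∘ suc) K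
  ∣d₀-x-[d₀-y]∣≡∣x-y∣ : ∣ d 0 - x - (d 0 - y) ∣ ≡ ∣ x - y ∣
  ∣d₀-x-[d₀-y]∣≡∣x-y∣ = trans (cong ∣_∣ (solve 3 (λ z x y → z :- x :- (z :- y) := :- (x :- y)) refl (d 0) x y)) (ℚₚ.∣-p∣≡∣p∣ (x - y))

alt-cauchy : ∀ {d} → NonNeg d → Antitone d → ∀ K i j → K ℕ.≤ i → K ℕ.≤ j → ∣ alt d i - alt d j ∣ ≤ d (suc K)
alt-cauchy {d} d≥0 d↓ K i j K≤i K≤j with ℕ.compare i j
... | ℕ.less .i N = ℚₚ.≤-trans (subst (_≤ d (suc i)) (∣x-y∣≡∣y-x∣ (alt d (suc (i ℕ.+ N))) (alt d i)) (alt-tail d≥0 d↓ i N)) (antitone-≤ d↓ (ℕ.s≤s K≤i))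
... | ℕ.equal .i = subst (_≤ d (suc K)) (cong ∣_∣ (sym (ℚₚ.+-inverseʳ (alt d i)))) (d≥0 (suc K))
... | ℕ.greater .j N = ℚₚ.≤-trans (alt-tail d≥0 d↓ j N) (antitone-≤ d↓ (ℕ.s≤s K≤j))

-- The telescoping identity and the numerical estimates

M : ℕ → ℕ
M j = b (suc j) ℕ.+ b j

M-pos : ∀ j → 0 ℕ.< M j
M-pos j = ℕₚ.≤-trans (b-pos (suc j)) (ℕₚ.m≤m+n _ _)

⅟b+⅟c≡⅟M+⅟M : ∀ j → ⅟ (b (suc j)) + ⅟ (c (b (suc j))) ≡ ⅟ (M j) + ⅟ (M (suc j))
⅟b+⅟c≡⅟M+⅟M j = begin
  ⅟ y + ⅟ (c y)                                    ≡⟨ ⅟-+ (b-pos (suc j)) (c∘b-pos j) ⟩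
  (c y ℕ.+ y) ÷ (y ℕ.* c y)                         ≡⟨ ÷-cong (c y ℕ.+ y) (y ℕ.* c y) (M (suc j) ℕ.+ M j) (M j ℕ.* M (suc j)) (ℕₚ.*-mono-< (b-pos (suc j)) (c∘b-pos j)) (ℕₚ.*-mono-< (M-pos j) (M-pos (suc j)))
                                                        (telescoping-identity (b j) y (b (suc (suc j))) (b-pos (suc j)) (b-rec j) (b-cassini j)) ⟩
  (M (suc j) ℕ.+ M j) ÷ (M j ℕ.* M (suc j))        ≡⟨ ⅟-+ (M-pos j) (M-pos (suc j)) ⟨
  ⅟ (M j) + ⅟ (M (suc j))                          ∎
  where
  open ≡-Reasoning
  y : ℕ
  y = b (suc j)

0<4* : ∀ {x} → 0 ℕ.< x → 0 ℕ.< 4 ℕ.* x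
0<4* = ℕₚ.*-mono-< {0} {4} (ℕ.s≤s ℕ.z≤n)

⅟4c₀+⅟c₁<⅟c₀ : ∀ {c₀ c₁} → 0 ℕ.< c₀ → 2 ℕ.* c₀ ℕ.≤ c₁ → ⅟ (4 ℕ.* c₀) + ⅟ c₁ < ⅟ c₀
⅟4c₀+⅟c₁<⅟c₀ {c₀} {c₁} 0<c₀ 2c₀≤c₁ = begin-strict
  ⅟ (4 ℕ.* c₀) + ⅟ c₁                          ≡⟨ ⅟-+ (0<4* 0<c₀) 0<c₁ ⟩
  (c₁ ℕ.+ 4 ℕ.* c₀) ÷ (4 ℕ.* c₀ ℕ.* c₁)        <⟨ ÷<⅟ (c₁ ℕ.+ 4 ℕ.* c₀) (ℕₚ.*-mono-< (0<4* 0<c₀) 0<c₁) 0<c₀ (c-cross c₀ c₁ 0<c₀ 2c₀≤c₁) ⟩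
  ⅟ c₀                                         ∎
  where
  open ℚₚ.≤-Reasoning
  0<c₁ : 0 ℕ.< c₁
  0<c₁ = ℕₚ.<-≤-trans 0<c₀ (ℕₚ.≤-trans (ℕₚ.m≤m+n c₀ (c₀ ℕ.+ 0)) 2c₀≤c₁)

⅟[m+1]+⅟4c₀+⅟c₀<⅟m : ∀ {m c₀} → 0 ℕ.< m → 0 ℕ.< c₀ → 5 ℕ.* m ℕ.* (m ℕ.+ 1) ℕ.< 4 ℕ.* c₀ →
  ⅟ (m ℕ.+ 1) + ⅟ (4 ℕ.* c₀) + ⅟ c₀ < ⅟ m
⅟[m+1]+⅟4c₀+⅟c₀<⅟m {m} {c₀} 0<m 0<c₀ 5m[m+1]<4c₀ = begin-strict
  ⅟ (m ℕ.+ 1) + ⅟ K + ⅟ c₀                                         ≡⟨ cong (_+ ⅟ c₀) (⅟-+ 0<m+1 (0<4* 0<c₀)) ⟩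
  (K ℕ.+ (m ℕ.+ 1)) ÷ ((m ℕ.+ 1) ℕ.* K) + ⅟ c₀                     ≡⟨ ÷+⅟ (K ℕ.+ (m ℕ.+ 1)) 0<[m+1]K 0<c₀ ⟩
  ((K ℕ.+ (m ℕ.+ 1)) ℕ.* c₀ ℕ.+ (m ℕ.+ 1) ℕ.* K) ÷ ((m ℕ.+ 1) ℕ.* K ℕ.* c₀)
                                                                   <⟨ ÷<⅟ ((K ℕ.+ (m ℕ.+ 1)) ℕ.* c₀ ℕ.+ (m ℕ.+ 1) ℕ.* K) (ℕₚ.*-mono-< 0<[m+1]K 0<c₀) 0<m (M-cross m c₀ 5m[m+1]<4c₀) ⟩
  ⅟ m                                                              ∎
  where
  open ℚₚ.≤-Reasoning
  K : ℕ
  K = 4 ℕ.* c₀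
  0<m+1 : 0 ℕ.< m ℕ.+ 1
  0<m+1 = ℕₚ.m≤n+m 1 m
  0<[m+1]K : 0 ℕ.< (m ℕ.+ 1) ℕ.* K
  0<[m+1]K = ℕₚ.*-mono-< 0<m+1 (0<4* 0<c₀)

-- Connection with the series of the statement

B≡+Bℕ : ∀ m → B m ≡ + Bℕ m
B≡+Bℕ 0 = refl
B≡+Bℕ 1 = refl
B≡+Bℕ (suc (suc m)) = begin
  + 6 ℤ.* B (suc m) ℤ.- B m               ≡⟨ cong₂ (λ u v → + 6 ℤ.* u ℤ.- v) (B≡+Bℕ (suc m)) (B≡+Bℕ m) ⟩
  + 6 ℤ.* + Bℕ (suc m) ℤ.- + Bℕ m         ≡⟨ cong (ℤ._- + Bℕ m) (ℤₚ.pos-* 6 (Bℕ (suc m))) ⟨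
  + (6 ℕ.* Bℕ (suc m)) ℤ.- + Bℕ m         ≡⟨ ℤₚ.m-n≡m⊖n (6 ℕ.* Bℕ (suc m)) (Bℕ m) ⟩
  (6 ℕ.* Bℕ (suc m)) ℤ.⊖ Bℕ m             ≡⟨ ℤₚ.⊖-≥ (Bℕ≤6*Bℕ[1+m] m) ⟩
  + Bℕ (suc (suc m))                      ∎
  where open ≡-Reasoning

term≡sgn*⅟b : ∀ k → term k ≡ sgn k * ⅟ (b k)
term≡sgn*⅟b k = cong (λ z → sgn k * inv (ι z)) (B≡+Bℕ (suc (2 ℕ.* k)))

B[2n+1]+B[2n-1]≡M : ∀ p → B (suc (2 ℕ.* suc p)) ℤ.+ B (2 ℕ.* suc p ℕ.∸ 1) ≡ + M p
B[2n+1]+B[2n-1]≡M p = cong₂ ℤ._+_ (B≡+Bℕ (suc (2 ℕ.* suc p))) (trans (cong B (ℕₚ.+-suc p (p ℕ.+ 0))) (B≡+Bℕ (suc (2 ℕ.* p))))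

ι[-[m+1]+1]≡-ιm : ∀ m → ι (ℤ.- (+ m ℤ.+ + 1) ℤ.+ + 1) ≡ - ι (+ m)
ι[-[m+1]+1]≡-ιm m = trans (cong ι (-[i+1]+1≡-i (+ m))) (ι-neg (+ m))
  where
  -[i+1]+1≡-i : ∀ i → ℤ.- (i ℤ.+ + 1) ℤ.+ + 1 ≡ ℤ.- i
  -[i+1]+1≡-i = solve-∀

floorInvLim-intro : ∀ s m N {δ ε} → 0ℚ < δ → 0ℚ < ε →
  (∀ j → N ℕ.≤ j → δ ≤ ∣ s j ∣) →
  (∀ j → N ℕ.≤ j → ι m ≤ inv (s j)) →
  (∀ j → N ℕ.≤ j → inv (s j) + ε ≤ ι (m ℤ.+ + 1)) →
  FloorInvLim s m
floorInvLim-intro s m N {δ} {ε} 0<δ 0<ε δ≤∣s∣ ιm≤inv-s inv-s+ε≤ιm+1 =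
  (δ , 0<δ , N , δ≤∣s∣) ,
  (λ ε′ 0<ε′ → N , λ j N≤j → ℚₚ.≤-trans (x-y≤x (ι m) (ℚₚ.<⇒≤ 0<ε′)) (ιm≤inv-s j N≤j)) ,
  (ε , 0<ε , N , inv-s+ε≤ιm+1)

floorInvLim-cong : ∀ {s t m} → (∀ j → s j ≡ t j) → FloorInvLim t m → FloorInvLim s m
floorInvLim-cong {s} {t} {m} s≡t ((δ , 0<δ , N , δ≤∣t∣) , ιm-ε≤inv-t , (ε , 0<ε , N′ , inv-t+ε≤ιm+1)) =
  (δ , 0<δ , N , λ j N≤j → subst (λ x → δ ≤ ∣ x ∣) (sym (s≡t j)) (δ≤∣t∣ j N≤j)) ,
  (λ ε′ 0<ε′ → let (N″ , below) = ιm-ε≤inv-t ε′ 0<ε′ in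
    N″ , λ j N″≤j → subst (λ x → ι m - ε′ ≤ inv x) (sym (s≡t j)) (below j N″≤j)) ,
  (ε , 0<ε , N′ , λ j N′≤j → subst (λ x → inv x + ε ≤ ι (m ℤ.+ + 1)) (sym (s≡t j)) (inv-t+ε≤ιm+1 j N′≤j))

-- The tail of the series starting at n = suc p.
module Tail (p : ℕ) where

  d e m : ℕ → ℚ
  d i = ⅟ (b (suc (i ℕ.+ p)))
  e i = ⅟ (c (b (suc (i ℕ.+ p))))
  m i = ⅟ (M (i ℕ.+ p))

  d≥0 : NonNeg d
  d≥0 i = ⅟-nonNeg (b (suc (i ℕ.+ p)))

  e≥0 : NonNeg e
  e≥0 i = ⅟-nonNeg (c (b (suc (i ℕ.+ p))))

  d↓ : Antitone d
  d↓ i = ⅟-antimono-≤ (b-pos (suc (i ℕ.+ p))) (b-mono (suc (i ℕ.+ p)))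

  e↓ : Antitone e
  e↓ i = ⅟-antimono-≤ (c∘b-pos (i ℕ.+ p)) (ℕₚ.≤-trans (ℕₚ.m≤m+n (c y) (c y ℕ.+ 0)) (c-double {y} (b-double (suc (i ℕ.+ p)))))
    where
    y : ℕ
    y = b (suc (i ℕ.+ p))

  alt-d≡ : ∀ j → alt d j ≡ m 0 + sgn j * m (suc j) - alt e j
  alt-d≡ = alt-telescope d e m (λ i → ⅟b+⅟c≡⅟M+⅟M (i ℕ.+ p))

  -- Beyond index K the boundary term m (suc j) is at most ⅟ K, which is small enough for hi < m 0 and ⅟ (M p + 1) < lo.
  c₀ c₁ K : ℕ
  c₀ = c (b (suc p))
  c₁ = c (b (suc (suc p)))
  K = 4 ℕ.* c₀

  0<c₀ : 0 ℕ.< c₀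
  0<c₀ = c∘b-pos p

  m[1+j]≤⅟K : ∀ j → K ℕ.≤ j → m (suc j) ≤ ⅟ K
  m[1+j]≤⅟K j K≤j = ⅟-antimono-≤ (0<4* 0<c₀) (begin
    K                        ≤⟨ K≤j ⟩
    j                        ≤⟨ ℕₚ.m≤m+n j p ⟩
    j ℕ.+ p                  ≤⟨ ℕₚ.n≤1+n _ ⟩
    suc (j ℕ.+ p)            ≤⟨ ℕₚ.<⇒≤ (n<b (suc (j ℕ.+ p))) ⟩
    b (suc (j ℕ.+ p))        ≤⟨ ℕₚ.m≤n+m _ _ ⟩
    M (suc j ℕ.+ p)          ∎)
    where open ℕₚ.≤-Reasoning

  hi lo : ℚ
  hi = m 0 + ⅟ K - (e 0 - e 1)
  lo = m 0 - ⅟ K - e 0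

  alt-d≤hi : ∀ j → K ℕ.≤ j → alt d j ≤ hi
  alt-d≤hi j K≤j = subst (_≤ hi) (sym (alt-d≡ j))
    (ℚₚ.+-mono-≤ (ℚₚ.+-monoʳ-≤ (m 0) (ℚₚ.≤-trans (proj₂ (sgn-bounds j (⅟-nonNeg (M (suc j ℕ.+ p))))) (m[1+j]≤⅟K j K≤j)))
                 (ℚₚ.neg-antimono-≤ (proj₁ (alt-bounds e≥0 e↓ j))))

  lo≤alt-d : ∀ j → K ℕ.≤ j → lo ≤ alt d j
  lo≤alt-d j K≤j = subst (lo ≤_) (sym (alt-d≡ j))
    (ℚₚ.+-mono-≤ (ℚₚ.+-monoʳ-≤ (m 0) (ℚₚ.≤-trans (ℚₚ.neg-antimono-≤ (m[1+j]≤⅟K j K≤j)) (proj₁ (sgn-bounds j (⅟-nonNeg (M (suc j ℕ.+ p)))))))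
                 (ℚₚ.neg-antimono-≤ (proj₂ (alt-bounds e≥0 e↓ j))))

  hi<m₀ : hi < m 0
  hi<m₀ = subst (_< m 0) (solve 4 (λ a k e₀ e₁ → a :+ ((k :+ e₁) :- e₀) := a :+ k :- (e₀ :- e₁)) refl (m 0) (⅟ K) (e 0) (e 1))
                (x+[y-z]<x (m 0) (⅟4c₀+⅟c₁<⅟c₀ 0<c₀ (c-double {b (suc p)} (b-double (suc p)))))

  ⅟[M+1]<lo : ⅟ (M p ℕ.+ 1) < lo
  ⅟[M+1]<lo = subst (_< lo) (solve 3 (λ a k e₀ → a :+ k :+ e₀ :- k :- e₀ := a) refl (⅟ (M p ℕ.+ 1)) (⅟ K) (e 0))
    (ℚₚ.+-monoˡ-< (- e 0) (ℚₚ.+-monoˡ-< (- ⅟ K)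
      (⅟[m+1]+⅟4c₀+⅟c₀<⅟m (M-pos p) 0<c₀ (5M[M+1]<4c (M p) y M≤2y 6≤y))))
    where
    y : ℕ
    y = b (suc p)
    M≤2y : M p ℕ.≤ 2 ℕ.* y
    M≤2y = ℕₚ.+-monoʳ-≤ y (ℕₚ.≤-trans (b-mono p) (ℕₚ.m≤m+n y 0))
    6≤y : 6 ℕ.≤ y
    6≤y = ℕₚ.≤-trans (ℕₚ.m≤m+n 6 29) (b-mono-≤ {1} {suc p} (ℕ.s≤s ℕ.z≤n))

  0<⅟[M+1] : 0ℚ < ⅟ (M p ℕ.+ 1)
  0<⅟[M+1] = ⅟-pos (ℕₚ.m≤n+m 1 (M p))

  ⅟[M+1]≤alt-d : ∀ j → K ℕ.≤ j → ⅟ (M p ℕ.+ 1) ≤ alt d j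
  ⅟[M+1]≤alt-d j K≤j = ℚₚ.≤-trans (ℚₚ.<⇒≤ ⅟[M+1]<lo) (lo≤alt-d j K≤j)

  0<alt-d : ∀ j → K ℕ.≤ j → 0ℚ < alt d j
  0<alt-d j K≤j = ℚₚ.<-≤-trans 0<⅟[M+1] (⅟[M+1]≤alt-d j K≤j)

  0<lo : 0ℚ < lo
  0<lo = ℚₚ.<-trans 0<⅟[M+1] ⅟[M+1]<lo

  0<hi : 0ℚ < hi
  0<hi = ℚₚ.<-≤-trans (0<alt-d K ℕₚ.≤-refl) (alt-d≤hi K ℕₚ.≤-refl)

  inv-alt-d-bounds : ∀ j → K ℕ.≤ j → inv hi ≤ inv (alt d j) × inv (alt d j) ≤ inv lo
  inv-alt-d-bounds j K≤j = inv-antimono-≤ (0<alt-d j K≤j) 0<hi (alt-d≤hi j K≤j) ,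
                           inv-antimono-≤ 0<lo (0<alt-d j K≤j) (lo≤alt-d j K≤j)

  ιM<inv-hi : ι (+ M p) < inv hi
  ιM<inv-hi = subst (_< inv hi) (inv-⅟ (M-pos p)) (inv-antimono-< 0<hi (⅟-pos (M-pos p)) hi<m₀)

  inv-lo<ι[M+1] : inv lo < ι (+ (M p ℕ.+ 1))
  inv-lo<ι[M+1] = subst (inv lo <_) (inv-⅟ (ℕₚ.m≤n+m 1 (M p))) (inv-antimono-< 0<⅟[M+1] 0<lo ⅟[M+1]<lo)

  partial≡sgn*alt-d : ∀ N → partial (suc p) N ≡ sgn (suc p) * alt d N
  partial≡sgn*alt-d zero = term≡sgn*⅟b (suc p)
  partial≡sgn*alt-d (suc N) = begin
    partial (suc p) N + term (suc p ℕ.+ suc N)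
      ≡⟨ cong₂ _+_ (partial≡sgn*alt-d N) (term≡sgn*⅟b (suc p ℕ.+ suc N)) ⟩
    σ * alt d N + sgn (suc p ℕ.+ suc N) * ⅟ (b (suc (p ℕ.+ suc N)))
      ≡⟨ cong₂ (λ s i → σ * alt d N + s * ⅟ (b (suc i))) (sgn-+ (suc p) (suc N)) (ℕₚ.+-comm p (suc N)) ⟩
    σ * alt d N + σ * sgn (suc N) * d (suc N)
      ≡⟨ solve 4 (λ s a t x → s :* a :+ s :* t :* x := s :* (a :+ t :* x)) refl σ (alt d N) (sgn (suc N)) (d (suc N)) ⟩
    σ * (alt d N + sgn (suc N) * d (suc N))
      ≡⟨ cong (σ *_) (alt-snoc d N) ⟨
    σ * alt d (suc N)
      ∎
    where
    open ≡-Reasoning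
    σ : ℚ
    σ = sgn (suc p)

  partial-cauchy : IsCauchy (partial (suc p))
  partial-cauchy ε 0<ε with ⅟-archimedean ε 0<ε
  ... | D , ⅟≤ε = D , λ i j D≤i D≤j → begin
    ∣ partial (suc p) i - partial (suc p) j ∣   ≡⟨ ∣partial-partial∣≡∣alt-alt∣ i j ⟩
    ∣ alt d i - alt d j ∣                       ≤⟨ alt-cauchy d≥0 d↓ D i j D≤i D≤j ⟩
    d (suc D)                                   ≤⟨ ⅟≤ε _ D≤b ⟩
    ε                                           ∎
    where
    open ℚₚ.≤-Reasoning
    D≤b : D ℕ.≤ b (suc (suc D ℕ.+ p))
    D≤b = ℕₚ.<⇒≤ (ℕₚ.<-≤-trans (n<b D) (b-mono-≤ (ℕₚ.≤-trans (ℕₚ.m≤m+n D p) (ℕₚ.m≤n+m (D ℕ.+ p) 2))))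
    ∣partial-partial∣≡∣alt-alt∣ : ∀ i j → ∣ partial (suc p) i - partial (suc p) j ∣ ≡ ∣ alt d i - alt d j ∣
    ∣partial-partial∣≡∣alt-alt∣ i j = begin-equality
      ∣ partial (suc p) i - partial (suc p) j ∣       ≡⟨ cong₂ (λ u v → ∣ u - v ∣) (partial≡sgn*alt-d i) (partial≡sgn*alt-d j) ⟩
      ∣ σ * alt d i - σ * alt d j ∣                   ≡⟨ cong ∣_∣ (solve 3 (λ s a b → s :* a :- s :* b := s :* (a :- b)) refl σ (alt d i) (alt d j)) ⟩
      ∣ σ * (alt d i - alt d j) ∣                     ≡⟨ ℚₚ.∣p*q∣≡∣p∣*∣q∣ σ (alt d i - alt d j) ⟩
      ∣ σ ∣ * ∣ alt d i - alt d j ∣                   ≡⟨ cong (_* ∣ alt d i - alt d j ∣) (∣sgn∣≡1 (suc p)) ⟩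
      1ℚ * ∣ alt d i - alt d j ∣                      ≡⟨ ℚₚ.*-identityˡ _ ⟩
      ∣ alt d i - alt d j ∣                           ∎
      where
      σ : ℚ
      σ = sgn (suc p)

  floor-alt-d : FloorInvLim (alt d) (+ M p)
  floor-alt-d = floorInvLim-intro (alt d) (+ M p) K 0<⅟[M+1] (0<y-x inv-lo<ι[M+1]) δ≤∣alt-d∣ ιM≤inv-alt-d inv-alt-d+ε≤ι[M+1]
    where
    δ≤∣alt-d∣ : ∀ j → K ℕ.≤ j → ⅟ (M p ℕ.+ 1) ≤ ∣ alt d j ∣
    δ≤∣alt-d∣ j K≤j = subst (⅟ (M p ℕ.+ 1) ≤_) (sym (ℚₚ.0≤p⇒∣p∣≡p (ℚₚ.<⇒≤ (0<alt-d j K≤j)))) (⅟[M+1]≤alt-d j K≤j)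
    ιM≤inv-alt-d : ∀ j → K ℕ.≤ j → ι (+ M p) ≤ inv (alt d j)
    ιM≤inv-alt-d j K≤j = ℚₚ.≤-trans (ℚₚ.<⇒≤ ιM<inv-hi) (proj₁ (inv-alt-d-bounds j K≤j))
    inv-alt-d+ε≤ι[M+1] : ∀ j → K ℕ.≤ j → inv (alt d j) + (ι (+ (M p ℕ.+ 1)) - inv lo) ≤ ι (+ (M p ℕ.+ 1))
    inv-alt-d+ε≤ι[M+1] j K≤j = x≤y⇒x+[z-y]≤z (ι (+ (M p ℕ.+ 1))) (proj₂ (inv-alt-d-bounds j K≤j))

  floor-neg-alt-d : FloorInvLim (λ j → - alt d j) (ℤ.- (+ M p ℤ.+ + 1))
  floor-neg-alt-d = floorInvLim-intro (λ j → - alt d j) (ℤ.- (+ M p ℤ.+ + 1)) K 0<⅟[M+1] (0<y-x (ℚₚ.neg-antimono-< ιM<inv-hi))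
    δ≤∣-alt-d∣ ι[-[M+1]]≤inv[-alt-d] inv[-alt-d]+ε≤-ιM
    where
    inv[-alt-d]≡-inv-alt-d : ∀ j → K ℕ.≤ j → inv (- alt d j) ≡ - inv (alt d j)
    inv[-alt-d]≡-inv-alt-d j K≤j = inv-neg (alt d j) (pos⇒≢0 (0<alt-d j K≤j))
    δ≤∣-alt-d∣ : ∀ j → K ℕ.≤ j → ⅟ (M p ℕ.+ 1) ≤ ∣ - alt d j ∣
    δ≤∣-alt-d∣ j K≤j = subst (⅟ (M p ℕ.+ 1) ≤_) (sym (trans (ℚₚ.∣-p∣≡∣p∣ (alt d j)) (ℚₚ.0≤p⇒∣p∣≡p (ℚₚ.<⇒≤ (0<alt-d j K≤j)))))
                         (⅟[M+1]≤alt-d j K≤j)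
    ι[-[M+1]]≤inv[-alt-d] : ∀ j → K ℕ.≤ j → ι (ℤ.- (+ M p ℤ.+ + 1)) ≤ inv (- alt d j)
    ι[-[M+1]]≤inv[-alt-d] j K≤j = subst₂ _≤_ (sym (ι-neg (+ M p ℤ.+ + 1))) (sym (inv[-alt-d]≡-inv-alt-d j K≤j))
      (ℚₚ.neg-antimono-≤ (ℚₚ.≤-trans (proj₂ (inv-alt-d-bounds j K≤j)) (ℚₚ.<⇒≤ inv-lo<ι[M+1])))
    inv[-alt-d]+ε≤-ιM : ∀ j → K ℕ.≤ j → inv (- alt d j) + (- ι (+ M p) - - inv hi) ≤ ι (ℤ.- (+ M p ℤ.+ + 1) ℤ.+ + 1)
    inv[-alt-d]+ε≤-ιM j K≤j = subst₂ _≤_ (cong (_+ (- ι (+ M p) - - inv hi)) (sym (inv[-alt-d]≡-inv-alt-d j K≤j))) (sym (ι[-[m+1]+1]≡-ιm (M p)))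
      (x≤y⇒x+[z-y]≤z (- ι (+ M p)) (ℚₚ.neg-antimono-≤ (proj₁ (inv-alt-d-bounds j K≤j))))

  floor-even : sgn (suc p) ≡ 1ℚ → FloorInvLim (partial (suc p)) (+ M p)
  floor-even σ≡1 = floorInvLim-cong {partial (suc p)} {alt d} {+ M p}
    (λ j → trans (partial≡sgn*alt-d j) (trans (cong (_* alt d j) σ≡1) (ℚₚ.*-identityˡ (alt d j))))
    floor-alt-d

  floor-odd : sgn (suc p) ≡ - 1ℚ → FloorInvLim (partial (suc p)) (ℤ.- (+ M p ℤ.+ + 1))
  floor-odd σ≡-1 = floorInvLim-cong {partial (suc p)} {λ j → - alt d j} {ℤ.- (+ M p ℤ.+ + 1)}
    (λ j → trans (partial≡sgn*alt-d j) (trans (cong (_* alt d j) σ≡-1) (solve 1 (λ x → (:- con 1ℚ) :* x := :- x) refl (alt d j))))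
    floor-neg-alt-d

theorem8 : ∀ (n : ℕ) → 1 ℕ.≤ n →
    IsCauchy (partial n) ×
    ((Even n → FloorInvLim (partial n) (B (suc (2 ℕ.* n)) ℤ.+ B (2 ℕ.* n ℕ.∸ 1))) ×
     (Odd n → FloorInvLim (partial n) (ℤ.- (B (suc (2 ℕ.* n)) ℤ.+ B (2 ℕ.* n ℕ.∸ 1) ℤ.+ + 1))))
theorem8 (suc p) _ =
  Tail.partial-cauchy p ,
  (λ even → subst (FloorInvLim (partial (suc p))) (sym (B[2n+1]+B[2n-1]≡M p)) (Tail.floor-even p (sgn-even even))) ,
  (λ odd → subst (λ z → FloorInvLim (partial (suc p)) (ℤ.- (z ℤ.+ + 1))) (sym (B[2n+1]+B[2n-1]≡M p)) (Tail.floor-odd p (sgn-odd odd)))
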